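{- Let $M$ be a simple binary matroid and let $C$ be a circuit of $M$. Then $C \subsetneq \mathrm{cl}(C)$ if and only if $C$ has a chord. Moreover, for an arbitrary (not necessarily binary) matroid, if a circuit $C$ has a chord then $C\subsetneq \mathrm{cl}(C)$, but the converse fails in general: there is a nonbinary matroid having a circuit $C$ with $C\subsetneq\mathrm{cl}(C)$ and no chord.
   Context: Matroids are finite, on a ground set $[n]=\{1,\dots,n\}$. A matroid is simple if all its circuits have at least three elements, and binary if the symmetric difference of any two different circuits is a union of disjoint circuits. The closure of $X\subseteq[n]$ is $\mathrm{cl}(X)=X\cup\{x\in[n]: \exists \text{ circuit } C,\ C\setminus X=\{x\}\}$. A circuit $C$ of a matroid has a chord $i_0$ if there are two circuits $C_1,C_2$ with $C_1\cap C_2=\{i_0\}$ and $C=C_1\,\Delta\, C_2$ (symmetric difference). -}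

module Defs where

open import Data.Nat using (ℕ; _≥_)
open import Data.Fin using (Fin)
open import Data.Fin.Subset using (Subset; ⊥; ⁅_⁆; _∈_; _∉_; _⊆_; _∩_; _∪_; _─_; _-_; ∣_∣; Empty; ⋃)
open import Data.List using (List)
open import Data.List.Relation.Unary.All using (All)
open import Data.List.Relation.Unary.AllPairs using (AllPairs)
open import Data.Product using (Σ; ∃; _×_)
open import Data.Sum using (_⊎_)
open import Relation.Nullary using (¬_)
open import Relation.Binary.PropositionalEquality using (_≡_; _≢_)

_Δ_ : ∀ {n} → Subset n → Subset n → Subset n
p Δ q = (p ─ q) ∪ (q ─ p)

record Matroid (n : ℕ) : Set₁ where
  field
    IsCircuit    : Subset n → Set
    empty-not    : ¬ IsCircuit ⊥
    incomparable : ∀ {C₁ C₂} → IsCircuit C₁ → IsCircuit C₂ → C₁ ⊆ C₂ → C₁ ≡ C₂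
    elimination  : ∀ {C₁ C₂ e} → IsCircuit C₁ → IsCircuit C₂ → C₁ ≢ C₂ →
                   e ∈ C₁ → e ∈ C₂ →
                   ∃ λ C₃ → IsCircuit C₃ × C₃ ⊆ ((C₁ ∪ C₂) - e)

open Matroid public

IsSimple : ∀ {n} → Matroid n → Set
IsSimple M = ∀ C → IsCircuit M C → ∣ C ∣ ≥ 3

IsBinary : ∀ {n} → Matroid n → Set
IsBinary M = ∀ C₁ C₂ → IsCircuit M C₁ → IsCircuit M C₂ → C₁ ≢ C₂ →
  ∃ λ (Cs : List (Subset _)) →
    All (IsCircuit M) Cs × AllPairs (λ A B → Empty (A ∩ B)) Cs × (C₁ Δ C₂ ≡ ⋃ Cs)

_∈cl[_]_ : ∀ {n} → Fin n → Matroid n → Subset n → Set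
x ∈cl[ M ] X = x ∈ X ⊎ (∃ λ C → IsCircuit M C × (C ─ X ≡ ⁅ x ⁆))

ProperInCl : ∀ {n} → Matroid n → Subset n → Set
ProperInCl M X = (∀ {x} → x ∈ X → x ∈cl[ M ] X) × ∃ (λ x → x ∈cl[ M ] X × x ∉ X)

HasChord : ∀ {n} → Matroid n → Subset n → Set
HasChord M C = ∃ λ i₀ → ∃ λ C₁ → ∃ λ C₂ →
  IsCircuit M C₁ × IsCircuit M C₂ × (C₁ ∩ C₂ ≡ ⁅ i₀ ⁆) × (C ≡ C₁ Δ C₂)

-- A chord i₀ = C₁ ∩ C₂ of C = C₁ Δ C₂ lies in cl(C) because C₁ ∖ C = {i₀}. Conversely,
-- let D be a circuit with D ∖ C = {x}. Every circuit G ⊆ C Δ D contains x: otherwise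
-- G ⊆ C, so G = C, which is impossible as C meets D (simplicity). In a binary matroid
-- C Δ D is a disjoint union of circuits, all of which contain x, so C Δ D is a single
-- circuit E, and x is a chord of C = D Δ E.
-- In the uniform matroid U₂,₄, whose circuits are the 3-subsets of a 4-set, the
-- circuit {0,1,2} has 3 in its closure via {0,1,3}. A symmetric difference of two
-- 3-sets has even size, so no circuit has a chord, and {0,1,2} Δ {0,1,3} = {2,3}
-- contains no circuit, so U₂,₄ is not binary.
module Submission where

open import Defs
open import Data.Bool using (true; false)
import Data.Bool as Bool
open import Data.Empty using (⊥-elim)
open import Data.Fin using (Fin; zero; suc)
import Data.Fin.Properties as Fin
open import Data.Fin.Subset using (Subset; ⊥; ⁅_⁆; _∈_; _∉_; _⊆_; _∩_; _∪_; _─_; _-_; ∣_∣; Empty; Nonempty; ⋃)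
open import Data.Fin.Subset.Properties
  using (_∈?_; _⊆?_; anySubset?; nonempty?; Empty-unique; ∉⊥; x∈⁅x⁆; x∈⁅y⁆⇒x≡y; ∣⁅x⁆∣≡1;
         p⊆p∪q; q⊆p∪q; x∈p∪q⁺; x∈p∪q⁻; x∈p∩q⁺; x∈p∩q⁻; x∈p∧x∉q⇒x∈p─q; ∪-identityʳ; p⊆q⇒∣p∣≤∣q∣)
open import Data.List using (List; []; _∷_)
open import Data.List.Relation.Unary.All using (All; _∷_)
open import Data.List.Relation.Unary.AllPairs using (AllPairs; _∷_)
open import Data.Nat using (ℕ; _≤_; s≤s; _≟_)
open import Data.Product using (∃; _×_; _,_; proj₁; proj₂)
open import Data.Sum using (inj₁; inj₂)
open import Data.Vec using ([]; _∷_; here; there; tail)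
open import Data.Vec.Properties using (≡-dec)
open import Function.Bundles using (_⇔_; mk⇔)
open import Relation.Nullary using (¬_; Dec; yes; no)
open import Relation.Nullary.Decidable using (from-yes; decidable-stable; ¬?; _→-dec_)
open import Relation.Binary.PropositionalEquality using (_≡_; _≢_; refl; sym; trans; cong; subst; module ≡-Reasoning)

private
  variable
    n : ℕ
    x : Fin n
    p q : Subset n

x∈p─q⁻ : x ∈ p ─ q → x ∈ p × x ∉ q
x∈p─q⁻ {p = true  ∷ _} {false ∷ _} here = here , λ ()
x∈p─q⁻ {x = zero} {p = true  ∷ _} {true  ∷ _} ()
x∈p─q⁻ {x = zero} {p = false ∷ _} {true  ∷ _} ()
x∈p─q⁻ {x = zero} {p = false ∷ _} {false ∷ _} ()
x∈p─q⁻ {p = _ ∷ _} {_ ∷ _} (there x∈p─q) with x∈p─q⁻ x∈p─q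
... | x∈p , x∉q = there x∈p , λ { (there x∈q) → x∉q x∈q }

x∉p∧x∈q⇒x∈pΔq : x ∉ p → x ∈ q → x ∈ p Δ q
x∉p∧x∈q⇒x∈pΔq x∉p x∈q = x∈p∪q⁺ (inj₂ (x∈p∧x∉q⇒x∈p─q x∈q x∉p))

x∈pΔq∧x∉p⇒x∈q─p : x ∈ p Δ q → x ∉ p → x ∈ q ─ p
x∈pΔq∧x∉p⇒x∈q─p {p = p} {q} x∈pΔq x∉p with x∈p∪q⁻ (p ─ q) (q ─ p) x∈pΔq
... | inj₁ x∈p─q = ⊥-elim (x∉p (proj₁ (x∈p─q⁻ x∈p─q)))
... | inj₂ x∈q─p = x∈q─p

x∈p∩q⇒x∉pΔq : x ∈ p → x ∈ q → x ∉ p Δ q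
x∈p∩q⇒x∉pΔq {p = p} {q} x∈p x∈q x∈pΔq with x∈p∪q⁻ (p ─ q) (q ─ p) x∈pΔq
... | inj₁ x∈p─q = proj₂ (x∈p─q⁻ x∈p─q) x∈q
... | inj₂ x∈q─p = proj₂ (x∈p─q⁻ x∈q─p) x∈p

p─[pΔq]≡p∩q : ∀ (p q : Subset n) → p ─ (p Δ q) ≡ p ∩ q
p─[pΔq]≡p∩q []           []           = refl
p─[pΔq]≡p∩q (true  ∷ p) (true  ∷ q) = cong (true ∷_)  (p─[pΔq]≡p∩q p q)
p─[pΔq]≡p∩q (true  ∷ p) (false ∷ q) = cong (false ∷_) (p─[pΔq]≡p∩q p q)
p─[pΔq]≡p∩q (false ∷ p) (true  ∷ q) = cong (false ∷_) (p─[pΔq]≡p∩q p q)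
p─[pΔq]≡p∩q (false ∷ p) (false ∷ q) = cong (false ∷_) (p─[pΔq]≡p∩q p q)

q∩[pΔq]≡q─p : ∀ (p q : Subset n) → q ∩ (p Δ q) ≡ q ─ p
q∩[pΔq]≡q─p []           []           = refl
q∩[pΔq]≡q─p (true  ∷ p) (true  ∷ q) = cong (false ∷_) (q∩[pΔq]≡q─p p q)
q∩[pΔq]≡q─p (true  ∷ p) (false ∷ q) = cong (false ∷_) (q∩[pΔq]≡q─p p q)
q∩[pΔq]≡q─p (false ∷ p) (true  ∷ q) = cong (true ∷_)  (q∩[pΔq]≡q─p p q)
q∩[pΔq]≡q─p (false ∷ p) (false ∷ q) = cong (false ∷_) (q∩[pΔq]≡q─p p q)

qΔ[pΔq]≡p : ∀ (p q : Subset n) → q Δ (p Δ q) ≡ p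
qΔ[pΔq]≡p []           []           = refl
qΔ[pΔq]≡p (true  ∷ p) (true  ∷ q) = cong (true ∷_)  (qΔ[pΔq]≡p p q)
qΔ[pΔq]≡p (true  ∷ p) (false ∷ q) = cong (true ∷_)  (qΔ[pΔq]≡p p q)
qΔ[pΔq]≡p (false ∷ p) (true  ∷ q) = cong (false ∷_) (qΔ[pΔq]≡p p q)
qΔ[pΔq]≡p (false ∷ p) (false ∷ q) = cong (false ∷_) (qΔ[pΔq]≡p p q)

p∩q≡⊥⇒p─q≡p : ∀ (p q : Subset n) → p ∩ q ≡ ⊥ → p ─ q ≡ p
p∩q≡⊥⇒p─q≡p []           []           _   = refl
p∩q≡⊥⇒p─q≡p (true  ∷ p) (false ∷ q) eq = cong (true ∷_)  (p∩q≡⊥⇒p─q≡p p q (cong tail eq))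
p∩q≡⊥⇒p─q≡p (false ∷ p) (true  ∷ q) eq = cong (false ∷_) (p∩q≡⊥⇒p─q≡p p q (cong tail eq))
p∩q≡⊥⇒p─q≡p (false ∷ p) (false ∷ q) eq = cong (false ∷_) (p∩q≡⊥⇒p─q≡p p q (cong tail eq))

q─p≡⁅x⁆∧G⊆pΔq∧x∉G⇒G⊆p : ∀ {G} → q ─ p ≡ ⁅ x ⁆ → G ⊆ p Δ q → x ∉ G → G ⊆ p
q─p≡⁅x⁆∧G⊆pΔq∧x∉G⇒G⊆p {p = p} {x = x} {G} q─p≡x G⊆pΔq x∉G {z} z∈G with z ∈? p
... | yes z∈p = z∈p
... | no  z∉p = ⊥-elim (x∉G (subst (_∈ G) z≡x z∈G))
  where
  z≡x : z ≡ x
  z≡x = x∈⁅y⁆⇒x≡y x (subst (z ∈_) q─p≡x (x∈pΔq∧x∉p⇒x∈q─p (G⊆pΔq z∈G) z∉p))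

Disjoint : Subset n → Subset n → Set
Disjoint p q = Empty (p ∩ q)

disjoint-cover-through-point⇒single :
  ∀ {P : Subset n → Set} {X : Subset n} {Cs : List (Subset n)} →
  All P Cs → AllPairs Disjoint Cs → X ≡ ⋃ Cs →
  x ∈ X → (∀ G → P G → G ⊆ X → x ∈ G) → ∃ λ E → P E × X ≡ E
disjoint-cover-through-point⇒single {x = x} {Cs = []} _ _ X≡⊥ x∈X _ =
  ⊥-elim (∉⊥ (subst (x ∈_) X≡⊥ x∈X))
disjoint-cover-through-point⇒single {Cs = E ∷ []} (PE ∷ _) _ X≡E∪⊥ _ _ =
  E , PE , trans X≡E∪⊥ (∪-identityʳ E)
disjoint-cover-through-point⇒single {x = x} {X = X} {Cs = E ∷ F ∷ Fs} (PE ∷ PF ∷ _) ((E∩F≡∅ ∷ _) ∷ _) X≡⋃ _ through =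
  ⊥-elim (E∩F≡∅ (x , x∈p∩q⁺ (through E PE E⊆X , through F PF F⊆X)))
  where
  E⊆X : E ⊆ X
  E⊆X x∈E = subst (_ ∈_) (sym X≡⋃) (p⊆p∪q (F ∪ ⋃ Fs) x∈E)
  F⊆X : F ⊆ X
  F⊆X x∈F = subst (_ ∈_) (sym X≡⋃) (q⊆p∪q E (F ∪ ⋃ Fs) (p⊆p∪q (⋃ Fs) x∈F))

module _ (M : Matroid n) where

  chord⇒properInCl : ∀ {C} → HasChord M C → ProperInCl M C
  chord⇒properInCl {C} (i₀ , C₁ , C₂ , C₁-circuit , _ , C₁∩C₂≡i₀ , C≡C₁ΔC₂) =
    inj₁ , i₀ , inj₂ (C₁ , C₁-circuit , C₁─C≡i₀) , i₀∉C
    where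
    open ≡-Reasoning
    C₁─C≡i₀ : C₁ ─ C ≡ ⁅ i₀ ⁆
    C₁─C≡i₀ = begin
      C₁ ─ C         ≡⟨ cong (C₁ ─_) C≡C₁ΔC₂ ⟩
      C₁ ─ (C₁ Δ C₂) ≡⟨ p─[pΔq]≡p∩q C₁ C₂ ⟩
      C₁ ∩ C₂        ≡⟨ C₁∩C₂≡i₀ ⟩
      ⁅ i₀ ⁆         ∎
    i₀∉C : i₀ ∉ C
    i₀∉C i₀∈C with x∈p∩q⁻ C₁ C₂ (subst (i₀ ∈_) (sym C₁∩C₂≡i₀) (x∈⁅x⁆ i₀))
    ... | i₀∈C₁ , i₀∈C₂ = x∈p∩q⇒x∉pΔq i₀∈C₁ i₀∈C₂ (subst (i₀ ∈_) C≡C₁ΔC₂ i₀∈C)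

  module _ {C D : Subset n} {x : Fin n} (D─C≡x : D ─ C ≡ ⁅ x ⁆) where

    circuit⊆Δ⇒∋x : IsCircuit M C → Nonempty (D ∩ C) →
                   ∀ {G} → IsCircuit M G → G ⊆ C Δ D → x ∈ G
    circuit⊆Δ⇒∋x C-circuit (y , y∈D∩C) {G} G-circuit G⊆CΔD with x ∈? G
    ... | yes x∈G = x∈G
    ... | no  x∉G = ⊥-elim (x∈p∩q⇒x∉pΔq y∈C y∈D (G⊆CΔD y∈G))
      where
      y∈D : y ∈ D
      y∈D = proj₁ (x∈p∩q⁻ D C y∈D∩C)
      y∈C : y ∈ C
      y∈C = proj₂ (x∈p∩q⁻ D C y∈D∩C)
      y∈G : y ∈ G
      y∈G = subst (y ∈_) (sym (incomparable M G-circuit C-circuit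
                                 (q─p≡⁅x⁆∧G⊆pΔq∧x∉G⇒G⊆p D─C≡x G⊆CΔD x∉G))) y∈C

    simple⇒meets : IsSimple M → IsCircuit M D → Nonempty (D ∩ C)
    simple⇒meets simple D-circuit with nonempty? (D ∩ C)
    ... | yes D∩C≢∅ = D∩C≢∅
    ... | no  D∩C≡∅ = ⊥-elim (3≰1 (subst (3 ≤_) ∣D∣≡1 (simple D D-circuit)))
      where
      3≰1 : ¬ 3 ≤ 1
      3≰1 (s≤s ())
      ∣D∣≡1 : ∣ D ∣ ≡ 1
      ∣D∣≡1 = begin
        ∣ D ∣     ≡⟨ cong ∣_∣ (sym (p∩q≡⊥⇒p─q≡p D C (Empty-unique D∩C≡∅))) ⟩
        ∣ D ─ C ∣ ≡⟨ cong ∣_∣ D─C≡x ⟩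
        ∣ ⁅ x ⁆ ∣ ≡⟨ ∣⁅x⁆∣≡1 x ⟩
        1         ∎
        where open ≡-Reasoning

    Δ-circuit⇒chord : IsCircuit M D → ∀ {E} → IsCircuit M E → C Δ D ≡ E → HasChord M C
    Δ-circuit⇒chord D-circuit {E} E-circuit CΔD≡E =
      x , D , E , D-circuit , E-circuit , D∩E≡x , sym C≡DΔE
      where
      open ≡-Reasoning
      D∩E≡x : D ∩ E ≡ ⁅ x ⁆
      D∩E≡x = begin
        D ∩ E       ≡⟨ cong (D ∩_) (sym CΔD≡E) ⟩
        D ∩ (C Δ D) ≡⟨ q∩[pΔq]≡q─p C D ⟩
        D ─ C       ≡⟨ D─C≡x ⟩
        ⁅ x ⁆       ∎
      C≡DΔE : D Δ E ≡ C
      C≡DΔE = trans (cong (D Δ_) (sym CΔD≡E)) (qΔ[pΔq]≡p C D)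

  properInCl⇒chord : IsSimple M → IsBinary M → ∀ {C} → IsCircuit M C → ProperInCl M C → HasChord M C
  properInCl⇒chord _ _ _ (_ , x , inj₁ x∈C , x∉C) = ⊥-elim (x∉C x∈C)
  properInCl⇒chord simple binary {C} C-circuit (_ , x , inj₂ (D , D-circuit , D─C≡x) , x∉C) =
    let E , E-circuit , CΔD≡E = CΔD-circuit in Δ-circuit⇒chord D─C≡x D-circuit E-circuit CΔD≡E
    where
    x∈D : x ∈ D
    x∈D = proj₁ (x∈p─q⁻ (subst (x ∈_) (sym D─C≡x) (x∈⁅x⁆ x)))
    C≢D : C ≢ D
    C≢D C≡D = x∉C (subst (x ∈_) (sym C≡D) x∈D)
    CΔD-circuit : ∃ λ E → IsCircuit M E × C Δ D ≡ E
    CΔD-circuit =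
      let _ , circuits , disjoint , CΔD≡⋃ = binary C D C-circuit D-circuit C≢D in
      disjoint-cover-through-point⇒single circuits disjoint CΔD≡⋃ (x∉p∧x∈q⇒x∈pΔq x∉C x∈D)
        (λ _ → circuit⊆Δ⇒∋x D─C≡x C-circuit (simple⇒meets D─C≡x simple D-circuit))

allSubsets? : ∀ {P : Subset n → Set} → (∀ p → Dec (P p)) → Dec (∀ p → P p)
allSubsets? P? with anySubset? (λ p → ¬? (P? p))
... | yes (p , ¬Pp) = no (λ ∀P → ¬Pp (∀P p))
... | no  ∄¬P       = yes (λ p → decidable-stable (P? p) (λ ¬Pp → ∄¬P (p , ¬Pp)))

_≟ₛ_ : (p q : Subset n) → Dec (p ≡ q)
_≟ₛ_ = ≡-dec Bool._≟_

3-subsets-incomparable : ∀ (a b : Subset 4) → ∣ a ∣ ≡ 3 → ∣ b ∣ ≡ 3 → a ⊆ b → a ≡ b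
3-subsets-incomparable = from-yes (allSubsets? λ (a : Subset 4) → allSubsets? λ (b : Subset 4) →
  (∣ a ∣ ≟ 3) →-dec (∣ b ∣ ≟ 3) →-dec (a ⊆? b) →-dec (a ≟ₛ b))

∣[a∪b]-e∣≡3 : ∀ (e : Fin 4) (a b : Subset 4) → ∣ a ∣ ≡ 3 → ∣ b ∣ ≡ 3 → a ≢ b → ∣ (a ∪ b) - e ∣ ≡ 3
∣[a∪b]-e∣≡3 = from-yes (Fin.all? λ e → allSubsets? λ (a : Subset 4) → allSubsets? λ (b : Subset 4) →
  (∣ a ∣ ≟ 3) →-dec (∣ b ∣ ≟ 3) →-dec ¬? (a ≟ₛ b) →-dec (∣ (a ∪ b) - e ∣ ≟ 3))

∣aΔb∣≢3 : ∀ (a b : Subset 4) → ∣ a ∣ ≡ 3 → ∣ b ∣ ≡ 3 → ∣ a Δ b ∣ ≢ 3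
∣aΔb∣≢3 = from-yes (allSubsets? λ (a : Subset 4) → allSubsets? λ (b : Subset 4) →
  (∣ a ∣ ≟ 3) →-dec (∣ b ∣ ≟ 3) →-dec ¬? (∣ a Δ b ∣ ≟ 3))

U₂₄ : Matroid 4
U₂₄ = record
  { IsCircuit    = λ p → ∣ p ∣ ≡ 3
  ; empty-not    = λ ()
  ; incomparable = λ {a} {b} → 3-subsets-incomparable a b
  ; elimination  = λ {a} {b} {e} a-circuit b-circuit a≢b _ _ →
      (a ∪ b) - e , ∣[a∪b]-e∣≡3 e a b a-circuit b-circuit a≢b , λ x∈ → x∈
  }

C₀ D₀ : Subset 4
C₀ = true ∷ true ∷ true  ∷ false ∷ []
D₀ = true ∷ true ∷ false ∷ true  ∷ []

U₂₄-not-binary : ¬ IsBinary U₂₄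
U₂₄-not-binary binary with binary C₀ D₀ refl refl (λ ())
... | [] , _ , _ , ()
... | E ∷ Es , ∣E∣≡3 ∷ _ , _ , C₀ΔD₀≡⋃ = 3≰2 (subst (_≤ 2) ∣E∣≡3 (p⊆q⇒∣p∣≤∣q∣ E⊆C₀ΔD₀))
  where
  3≰2 : ¬ 3 ≤ 2
  3≰2 (s≤s (s≤s ()))
  E⊆C₀ΔD₀ : E ⊆ C₀ Δ D₀
  E⊆C₀ΔD₀ x∈E = subst (_ ∈_) (sym C₀ΔD₀≡⋃) (p⊆p∪q (⋃ Es) x∈E)

U₂₄-no-chord : ¬ HasChord U₂₄ C₀
U₂₄-no-chord (_ , a , b , ∣a∣≡3 , ∣b∣≡3 , _ , C₀≡aΔb) =
  ∣aΔb∣≢3 a b ∣a∣≡3 ∣b∣≡3 (cong ∣_∣ (sym C₀≡aΔb))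

U₂₄-C₀-properInCl : ProperInCl U₂₄ C₀
U₂₄-C₀-properInCl = inj₁ , suc (suc (suc zero)) , inj₂ (D₀ , refl , refl) ,
  λ { (there (there (there ()))) }

lemma2p1 :
    ((n : ℕ) (M : Matroid n) → IsSimple M → IsBinary M →
       ∀ C → IsCircuit M C → (ProperInCl M C ⇔ HasChord M C))
    × ((n : ℕ) (M : Matroid n) → ∀ C → IsCircuit M C → HasChord M C → ProperInCl M C)
    × (∃ λ (n : ℕ) → ∃ λ (M : Matroid n) → ¬ IsBinary M ×
         ∃ λ C → IsCircuit M C × ProperInCl M C × ¬ HasChord M C)
lemma2p1 =
  (λ n M simple binary C C-circuit →
     mk⇔ (properInCl⇒chord M simple binary C-circuit) (chord⇒properInCl M)) ,
  (λ n M C _ → chord⇒properInCl M) ,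
  4 , U₂₄ , U₂₄-not-binary , C₀ , refl , U₂₄-C₀-properInCl , U₂₄-no-chord
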